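{- Let $A=(a,\,(u+1)a+d,\,((s+1)u+1)a+(s+1)d)$, where $u$ is a positive integer, $d$ is a positive integer with $\gcd(a,d)=1$, $a\ge 2$, and $s$ is an integer with $u+1\ge s\ge 1$. Let $p$ be a positive divisor of $a$ with $p\ne a$. Then $$F\left(\frac{\langle A\rangle}{p}\right)=\left(a-p-s\left\lfloor\frac{a-p}{s+1}\right\rfloor\right)\frac{a}{p}+\left(\frac{a}{p}-1\right)(ua+d)-\frac{a}{p},$$ and $$g\left(\frac{\langle A\rangle}{p}\right)=\left(\frac{a}{p}-1\right)\cdot\frac{ua+a+d-1}{2}-s\sum_{r=1}^{\frac{a}{p}-1}\left\lfloor\frac{rp}{s+1}\right\rfloor.$$
   Context: $\mathbb{N}$ denotes the non-negative integers; $\langle A\rangle$ is the set of non-negative integer linear combinations of the entries of $A$, and $\frac{\langle A\rangle}{p}=\{x\in\mathbb{N}\mid px\in\langle A\rangle\}$, a numerical semigroup. $F(S)$ is the largest integer not in the numerical semigroup $S$ (Frobenius number) and $g(S)$ is the number of positive integers not in $S$ (genus). -}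

module Defs where

open import Data.Nat using (ℕ; suc; _+_; _*_; _<_; _≤_)
open import Data.List using (List; length)
open import Data.List.Membership.Propositional using (_∈_)
open import Data.List.Relation.Unary.Unique.Propositional using (Unique)
open import Data.Product using (Σ; ∃; _×_)
open import Relation.Binary.PropositionalEquality using (_≡_)
open import Relation.Nullary using (¬_)
open import Function.Bundles using (_⇔_)

Subsetℕ : Set₁
Subsetℕ = ℕ → Set

⟨_,_,_⟩ : ℕ → ℕ → ℕ → Subsetℕ
⟨ a₁ , a₂ , a₃ ⟩ n = ∃ λ x → ∃ λ y → ∃ λ z → x * a₁ + y * a₂ + z * a₃ ≡ n

_÷_ : Subsetℕ → ℕ → Subsetℕ
(S ÷ p) x = S (p * x)

IsFrobenius : Subsetℕ → ℕ → Set
IsFrobenius S f = ¬ S f × (∀ m → f < m → S m)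

IsGenus : Subsetℕ → ℕ → Set
IsGenus S g = Σ (List ℕ) λ gs →
  Unique gs × (∀ n → (n ∈ gs) ⇔ (1 ≤ n × ¬ S n)) × length gs ≡ g

-- Write q = a / p and m = u a + d, so that the generators are a, a + m and a + (s + 1) m.
-- As gcd (p, m) = 1, y lies in ⟨A⟩/p exactly when y = t q + r m with t at least
-- coins s (r p), the fewest coins of values 1 and s + 1 paying r p.  For r < q the least
-- such element, apery r = coins s (r p) q + r m, is the least element of its residue
-- class mod q (r ↦ r m permutes the classes), and it increases with r because
-- (s - 1) q ≤ m.  Selmer's formulas F = apery (q - 1) - q and g = Σ_{r<q} ⌊apery r / q⌋
-- then give the result, the sum being evaluated by pairing r with q - r.
module Submission where

open import Data.Empty using (⊥-elim)
open import Data.List using (List; []; _∷_; _++_; map; concat; applyUpTo; upTo; length)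
open import Data.List.Membership.Propositional using (_∈_)
open import Data.List.Membership.Propositional.Properties
  using (∈-applyUpTo⁺; ∈-applyUpTo⁻; ∈-concat⁺′; ∈-concat⁻′)
open import Data.List.Properties using (length-++; map-applyUpTo; applyUpTo-∷ʳ; length-applyUpTo; map-upTo)
import Data.List.Relation.Unary.All.Properties as All
import Data.List.Relation.Unary.AllPairs.Properties as AllPairs
open import Data.List.Relation.Unary.Unique.Propositional using (Unique)
import Data.List.Relation.Unary.Unique.Propositional.Properties as Unique
open import Data.Nat
  using (ℕ; zero; suc; pred; _+_; _*_; _∸_; _/_; _%_; _≤_; _<_; _≤?_; z≤n; s≤s; s≤s⁻¹; z<s; s<s;
         NonZero; >-nonZero; >-nonZero⁻¹)
open import Data.Nat.Coprimality using (Coprime; coprime-Bézout; coprime-divisor; gcd≡1⇒coprime)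
open import Data.Nat.Divisibility using (_∣_; divides; divides-refl; ∣-trans; ∣m+n∣m⇒∣n; n∣m*n; m∣m*n)
open import Data.Nat.DivMod
open import Data.Nat.GCD using (gcd; module Bézout)
open import Data.Nat.ListAction using (sum)
open import Data.Nat.ListAction.Properties using (sum-++)
open import Data.Nat.Properties
open import Data.Nat.Tactic.RingSolver using (solve-∀)
open import Data.Product using (_×_; ∃; _,_; proj₁; proj₂)
open import Data.Sum using (inj₁; inj₂)
open import Function using (_∘_)
open import Function.Bundles using (_⇔_; mk⇔; module Equivalence)
open import Relation.Binary.PropositionalEquality
open import Relation.Nullary using (¬_; yes; no)

open import Defs

sum-applyUpTo-cong : ∀ {f g : ℕ → ℕ} n → (∀ {i} → i < n → f i ≡ g i) →
                     sum (applyUpTo f n) ≡ sum (applyUpTo g n)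
sum-applyUpTo-cong zero    f≡g = refl
sum-applyUpTo-cong (suc n) f≡g = cong₂ _+_ (f≡g z<s) (sum-applyUpTo-cong n (f≡g ∘ s<s))

sum-applyUpTo-+ : ∀ (f g : ℕ → ℕ) n →
                  sum (applyUpTo (λ i → f i + g i) n) ≡ sum (applyUpTo f n) + sum (applyUpTo g n)
sum-applyUpTo-+ f g zero    = refl
sum-applyUpTo-+ f g (suc n) = begin
  f 0 + g 0 + sum (applyUpTo (λ i → f (suc i) + g (suc i)) n)
    ≡⟨ cong (f 0 + g 0 +_) (sum-applyUpTo-+ (f ∘ suc) (g ∘ suc) n) ⟩
  f 0 + g 0 + (sum (applyUpTo (f ∘ suc) n) + sum (applyUpTo (g ∘ suc) n))
    ≡⟨ interchange (f 0) (g 0) _ _ ⟩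
  f 0 + sum (applyUpTo (f ∘ suc) n) + (g 0 + sum (applyUpTo (g ∘ suc) n)) ∎
  where
  open ≡-Reasoning
  interchange : ∀ w x y z → w + x + (y + z) ≡ w + y + (x + z)
  interchange = solve-∀

*-distribˡ-sum-applyUpTo : ∀ c (f : ℕ → ℕ) n →
                           c * sum (applyUpTo f n) ≡ sum (applyUpTo (λ i → c * f i) n)
*-distribˡ-sum-applyUpTo c f zero    = *-zeroʳ c
*-distribˡ-sum-applyUpTo c f (suc n) =
  trans (*-distribˡ-+ c (f 0) _) (cong (c * f 0 +_) (*-distribˡ-sum-applyUpTo c (f ∘ suc) n))

sum-applyUpTo-reverse : ∀ (f : ℕ → ℕ) n →
                        sum (applyUpTo f n) ≡ sum (applyUpTo (λ i → f (n ∸ suc i)) n)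
sum-applyUpTo-reverse f zero    = refl
sum-applyUpTo-reverse f (suc n) = begin
  sum (applyUpTo f (suc n))
    ≡⟨ cong sum (applyUpTo-∷ʳ f n) ⟨
  sum (applyUpTo f n ++ f n ∷ [])
    ≡⟨ sum-++ (applyUpTo f n) (f n ∷ []) ⟩
  sum (applyUpTo f n) + (f n + 0)
    ≡⟨ cong₂ _+_ (sum-applyUpTo-reverse f n) (+-identityʳ (f n)) ⟩
  sum (applyUpTo (λ i → f (n ∸ suc i)) n) + f n
    ≡⟨ +-comm _ (f n) ⟩
  f n + sum (applyUpTo (λ i → f (n ∸ suc i)) n) ∎
  where open ≡-Reasoning

sum-applyUpTo-pairing : ∀ (f : ℕ → ℕ) n c → (∀ {i} → i < n → f i + f (n ∸ suc i) ≡ c) →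
                        2 * sum (applyUpTo f n) ≡ n * c
sum-applyUpTo-pairing f n c pair = begin
  2 * sum (applyUpTo f n)
    ≡⟨ cong (sum (applyUpTo f n) +_) (+-identityʳ _) ⟩
  sum (applyUpTo f n) + sum (applyUpTo f n)
    ≡⟨ cong (sum (applyUpTo f n) +_) (sum-applyUpTo-reverse f n) ⟩
  sum (applyUpTo f n) + sum (applyUpTo (λ i → f (n ∸ suc i)) n)
    ≡⟨ sum-applyUpTo-+ f (λ i → f (n ∸ suc i)) n ⟨
  sum (applyUpTo (λ i → f i + f (n ∸ suc i)) n)
    ≡⟨ sum-applyUpTo-cong n pair ⟩
  sum (applyUpTo (λ _ → c) n)
    ≡⟨ sum-applyUpTo-const c n ⟩
  n * c ∎
  where
  open ≡-Reasoning
  sum-applyUpTo-const : ∀ c n → sum (applyUpTo (λ _ → c) n) ≡ n * c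
  sum-applyUpTo-const c zero    = refl
  sum-applyUpTo-const c (suc n) = cong (c +_) (sum-applyUpTo-const c n)

length-concat : ∀ {A : Set} (xss : List (List A)) → length (concat xss) ≡ sum (map length xss)
length-concat []         = refl
length-concat (xs ∷ xss) = trans (length-++ xs) (cong (length xs +_) (length-concat xss))

module _ {q : ℕ} .{{_ : NonZero q}} where

  %-*-congʳ : ∀ {m n} o → m % q ≡ n % q → (m * o) % q ≡ (n * o) % q
  %-*-congʳ {m} {n} o m≡n = begin
    (m * o) % q              ≡⟨ %-distribˡ-* m o q ⟩
    (m % q * (o % q)) % q    ≡⟨ cong (λ r → (r * (o % q)) % q) m≡n ⟩
    (n % q * (o % q)) % q    ≡⟨ %-distribˡ-* n o q ⟨
    (n * o) % q              ∎
    where open ≡-Reasoning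

  %-*-congˡ : ∀ o {m n} → m % q ≡ n % q → (o * m) % q ≡ (o * n) % q
  %-*-congˡ o {m} {n} m≡n = begin
    (o * m) % q ≡⟨ cong (_% q) (*-comm o m) ⟩
    (m * o) % q ≡⟨ %-*-congʳ o m≡n ⟩
    (n * o) % q ≡⟨ cong (_% q) (*-comm n o) ⟩
    (o * n) % q ∎
    where open ≡-Reasoning

  %≡∧<⇒/< : ∀ {m n} → m % q ≡ n % q → m < n → m / q < n / q
  %≡∧<⇒/< {m} {n} m≡n m<n = *-cancelʳ-< q (m / q) (n / q) (+-cancelˡ-< (m % q) _ _ (begin-strict
    m % q + m / q * q ≡⟨ m≡m%n+[m/n]*n m q ⟨
    m                 <⟨ m<n ⟩
    n                 ≡⟨ m≡m%n+[m/n]*n n q ⟩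
    n % q + n / q * q ≡⟨ cong (_+ n / q * q) m≡n ⟨
    m % q + n / q * q ∎))
    where open ≤-Reasoning

  %≡∧<⇒+≤ : ∀ {m n} → m % q ≡ n % q → m < n → m + q ≤ n
  %≡∧<⇒+≤ {m} {n} m≡n m<n = begin
    m + q                     ≡⟨ cong (_+ q) (m≡m%n+[m/n]*n m q) ⟩
    m % q + m / q * q + q     ≡⟨ +-assoc (m % q) _ q ⟩
    m % q + (m / q * q + q)   ≡⟨ cong (m % q +_) (+-comm (m / q * q) q) ⟩
    m % q + suc (m / q) * q   ≤⟨ +-mono-≤ (≤-reflexive m≡n) (*-monoˡ-≤ q (%≡∧<⇒/< m≡n m<n)) ⟩
    n % q + n / q * q         ≡⟨ m≡m%n+[m/n]*n n q ⟨
    n                         ∎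
    where open ≤-Reasoning

  %≡∧≤⇒+* : ∀ {m n} → m % q ≡ n % q → m ≤ n → ∃ λ k → n ≡ m + k * q
  %≡∧≤⇒+* {m} {n} m≡n m≤n = n / q ∸ m / q , (begin
    n
      ≡⟨ m≡m%n+[m/n]*n n q ⟩
    n % q + n / q * q
      ≡⟨ cong₂ (λ r k → r + k * q) m≡n (m+[n∸m]≡n (/-monoˡ-≤ q m≤n)) ⟨
    m % q + (m / q + (n / q ∸ m / q)) * q
      ≡⟨ rearrange (m % q) (m / q) _ q ⟩
    m % q + m / q * q + (n / q ∸ m / q) * q
      ≡⟨ cong (_+ (n / q ∸ m / q) * q) (m≡m%n+[m/n]*n m q) ⟨
    m + (n / q ∸ m / q) * q ∎)
    where
    open ≡-Reasoning
    rearrange : ∀ r a b q → r + (a + b) * q ≡ r + a * q + b * q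
    rearrange = solve-∀

  /-pairing : ∀ {x y m} → x + y ≡ m * q → x % q ≢ 0 → suc (x / q + y / q) ≡ m
  /-pairing {x} {y} {m} x+y≡mq x%q≢0 = ≤-antisym A<m (s≤s⁻¹ m<2+A)
    where
    open ≤-Reasoning
    A = x / q + y / q
    r = x % q + y % q
    rearrange : ∀ a b c d q → a + b * q + (c + d * q) ≡ a + c + (b + d) * q
    rearrange = solve-∀
    x+y≡r+Aq : x + y ≡ r + A * q
    x+y≡r+Aq = trans (cong₂ _+_ (m≡m%n+[m/n]*n x q) (m≡m%n+[m/n]*n y q))
                     (rearrange (x % q) (x / q) (y % q) (y / q) q)
    A<m : A < m
    A<m = *-cancelʳ-< q A m (begin-strict
      A * q     <⟨ m<n+m (A * q) (≤-trans (n≢0⇒n>0 x%q≢0) (m≤m+n (x % q) (y % q))) ⟩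
      r + A * q ≡⟨ x+y≡r+Aq ⟨
      x + y     ≡⟨ x+y≡mq ⟩
      m * q     ∎)
    m<2+A : m < 2 + A
    m<2+A = *-cancelʳ-< q m (2 + A) (begin-strict
      m * q         ≡⟨ x+y≡mq ⟨
      x + y         ≡⟨ x+y≡r+Aq ⟩
      r + A * q     <⟨ +-monoˡ-< (A * q) (+-mono-< (m%n<n x q) (m%n<n y q)) ⟩
      q + q + A * q ≡⟨ +-assoc q q (A * q) ⟩
      (2 + A) * q   ∎)

%-inverse : ∀ m q .{{_ : NonZero q}} → Coprime m q → ∃ λ x → (x * m) % q ≡ 1 % q
%-inverse m q@(suc n) m⊥q with coprime-Bézout m⊥q
... | Bézout.+- x y 1+yq≡xm = x , (begin
  (x * m) % q     ≡⟨ cong (_% q) 1+yq≡xm ⟨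
  (1 + y * q) % q ≡⟨ [m+kn]%n≡m%n 1 y q ⟩
  1 % q           ∎)
  where open ≡-Reasoning
-- Here x m ≡ -1 (mod q), so (q - 1) x inverts m.
... | Bézout.-+ x y 1+xm≡yq = n * x , (begin
  (n * x * m) % q     ≡⟨ [m+n]%n≡m%n (n * x * m) q ⟨
  (n * x * m + q) % q ≡⟨ cong (_% q) (trans (rearrange n x m) (cong (λ k → suc (n * k)) 1+xm≡yq)) ⟩
  (1 + n * (y * q)) % q ≡⟨ cong (λ k → (1 + k) % q) (*-assoc n y q) ⟨
  (1 + n * y * q) % q ≡⟨ [m+kn]%n≡m%n 1 (n * y) q ⟩
  1 % q               ∎)
  where
  open ≡-Reasoning
  rearrange : ∀ n x m → n * x * m + suc n ≡ suc (n * (1 + x * m))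
  rearrange = solve-∀

module _ {q m : ℕ} .{{_ : NonZero q}} (m⊥q : Coprime m q) where

  private
    x = proj₁ (%-inverse m q m⊥q)
    xm≡1 = proj₂ (%-inverse m q m⊥q)

    *-inverse : ∀ r → (r * (x * m)) % q ≡ r % q
    *-inverse r = trans (%-*-congˡ r xm≡1) (cong (_% q) (*-identityʳ r))

  *-cancelʳ-% : ∀ {r r'} → r < q → r' < q → (r * m) % q ≡ (r' * m) % q → r ≡ r'
  *-cancelʳ-% {r} {r'} r<q r'<q eq = begin
    r                    ≡⟨ m<n⇒m%n≡m r<q ⟨
    r % q                ≡⟨ undo r ⟨
    (r * m * x) % q      ≡⟨ %-*-congʳ x eq ⟩
    (r' * m * x) % q     ≡⟨ undo r' ⟩
    r' % q               ≡⟨ m<n⇒m%n≡m r'<q ⟩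
    r'                   ∎
    where
    open ≡-Reasoning
    undo : ∀ r → (r * m * x) % q ≡ r % q
    undo r = trans (cong (_% q) (trans (*-assoc r m x) (cong (r *_) (*-comm m x)))) (*-inverse r)

  *-surjectiveʳ-% : ∀ y → ∃ λ r → r < q × (r * m) % q ≡ y % q
  *-surjectiveʳ-% y = (y * x) % q , m%n<n (y * x) q , (begin
    ((y * x) % q * m) % q ≡⟨ %-*-congʳ m (m%n%n≡m%n (y * x) q) ⟩
    (y * x * m) % q       ≡⟨ cong (_% q) (*-assoc y x m) ⟩
    (y * (x * m)) % q     ≡⟨ *-inverse y ⟩
    y % q                 ∎)
    where open ≡-Reasoning

coins : ℕ → ℕ → ℕ
coins s k = k % suc s + k / suc s

coins+s*/ : ∀ s k → coins s k + s * (k / suc s) ≡ k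
coins+s*/ s k = trans (rearrange (k % suc s) (k / suc s) s) (sym (m≡m%n+[m/n]*n k (suc s)))
  where
  rearrange : ∀ r Q s → r + Q + s * Q ≡ r + Q * suc s
  rearrange = solve-∀

coins-minimal : ∀ s y z → coins s (y + z * suc s) ≤ y + z
coins-minimal s y z = begin
  (y + z * S) % S + (y + z * S) / S
    ≡⟨ cong₂ _+_ ([m+kn]%n≡m%n y z S) (+-distrib-/-∣ʳ y (divides-refl z)) ⟩
  y % S + (y / S + z * S / S)       ≡⟨ cong (λ k → y % S + (y / S + k)) (m*n/n≡m z S) ⟩
  y % S + (y / S + z)               ≡⟨ +-assoc (y % S) (y / S) z ⟨
  y % S + y / S + z                 ≤⟨ +-monoˡ-≤ z (+-monoʳ-≤ (y % S) (m≤m*n (y / S) S)) ⟩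
  y % S + y / S * S + z             ≡⟨ cong (_+ z) (m≡m%n+[m/n]*n y S) ⟨
  y + z                             ∎
  where
  open ≤-Reasoning
  S = suc s

coins-almost-monotone : ∀ s {k k'} → k ≤ k' → coins s k ≤ coins s k' + (s ∸ 1)
coins-almost-monotone s {k} {k'} k≤k' with m≤n⇒m<n∨m≡n (/-monoˡ-≤ (suc s) k≤k')
... | inj₁ k/S<k'/S = begin
  k % S + k / S           ≤⟨ +-monoˡ-≤ (k / S) (s≤s⁻¹ (m%n<n k S)) ⟩
  s + k / S               ≤⟨ +-monoˡ-≤ (k / S) (m≤n+m∸n s 1) ⟩
  suc (s ∸ 1) + k / S     ≡⟨ +-suc (s ∸ 1) (k / S) ⟨
  (s ∸ 1) + suc (k / S)   ≤⟨ +-monoʳ-≤ (s ∸ 1) (≤-trans k/S<k'/S (m≤n+m (k' / S) (k' % S))) ⟩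
  (s ∸ 1) + coins s k'    ≡⟨ +-comm (s ∸ 1) (coins s k') ⟩
  coins s k' + (s ∸ 1)    ∎
  where
  open ≤-Reasoning
  S = suc s
... | inj₂ k/S≡k'/S = begin
  k % S + k / S           ≤⟨ +-monoˡ-≤ (k / S) k%S≤k'%S ⟩
  k' % S + k / S          ≡⟨ cong (k' % S +_) k/S≡k'/S ⟩
  coins s k'              ≤⟨ m≤m+n (coins s k') (s ∸ 1) ⟩
  coins s k' + (s ∸ 1)    ∎
  where
  open ≤-Reasoning
  S = suc s
  k%S≤k'%S : k % S ≤ k' % S
  k%S≤k'%S = +-cancelʳ-≤ (k / S * S) (k % S) (k' % S) (begin
    k % S + k / S * S  ≡⟨ m≡m%n+[m/n]*n k S ⟨
    k                  ≤⟨ k≤k' ⟩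
    k'                 ≡⟨ m≡m%n+[m/n]*n k' S ⟩
    k' % S + k' / S * S ≡⟨ cong (λ Q → k' % S + Q * S) k/S≡k'/S ⟨
    k' % S + k / S * S ∎)

-- Selmer's formulas, for T given by its Apéry set w 0, …, w (q - 1) with respect to q.
module Apéry {T : Subsetℕ} {q : ℕ} .{{_ : NonZero q}} (w : ℕ → ℕ)
  (residue-injective : ∀ {r r'} → r < q → r' < q → w r % q ≡ w r' % q → r ≡ r')
  (residue-surjective : ∀ y → ∃ λ r → r < q × w r % q ≡ y % q)
  (∈⇔w≤ : ∀ {r y} → r < q → w r % q ≡ y % q → T y ⇔ w r ≤ y)
  where

  open Equivalence using (to; from)

  isFrobenius : ∀ {r} → r < q → (∀ {r'} → r' < q → w r' ≤ w r) → q ≤ w r →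
                IsFrobenius T (w r ∸ q)
  isFrobenius {r} r<q w≤w[r] q≤w[r] = F∉T , F<⇒∈T
    where
    open ≤-Reasoning
    F = w r ∸ q
    F+q≡w[r] : F + q ≡ w r
    F+q≡w[r] = m∸n+n≡m q≤w[r]
    F∉T : ¬ T F
    F∉T F∈T = <⇒≱ (subst (F <_) F+q≡w[r] (m<m+n F (>-nonZero⁻¹ q)))
                   (to (∈⇔w≤ r<q (trans (cong (_% q) (sym F+q≡w[r])) ([m+n]%n≡m%n F q))) F∈T)
    F<⇒∈T : ∀ y → F < y → T y
    F<⇒∈T y F<y with residue-surjective y
    ... | r' , r'<q , w[r']≡y with w r' ≤? y
    ...   | yes w[r']≤y = from (∈⇔w≤ r'<q w[r']≡y) w[r']≤y
    ...   | no  w[r']≰y = ⊥-elim (<⇒≱ F<y (+-cancelʳ-≤ q y F (begin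
      y + q ≤⟨ %≡∧<⇒+≤ (sym w[r']≡y) (≰⇒> w[r']≰y) ⟩
      w r'  ≤⟨ w≤w[r] r'<q ⟩
      w r   ≡⟨ F+q≡w[r] ⟨
      F + q ∎)))

  block : ℕ → List ℕ
  block r = applyUpTo (λ i → w r % q + i * q) (w r / q)

  ∈-block⁻ : ∀ {r y} → y ∈ block r → w r % q ≡ y % q × y < w r
  ∈-block⁻ {r} y∈block with ∈-applyUpTo⁻ _ y∈block
  ... | i , i<w[r]/q , refl = sym residue , (begin-strict
    w r % q + i * q         <⟨ +-monoʳ-< (w r % q) (*-monoˡ-< q i<w[r]/q) ⟩
    w r % q + w r / q * q   ≡⟨ m≡m%n+[m/n]*n (w r) q ⟨
    w r                     ∎)
    where
    open ≤-Reasoning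
    residue : (w r % q + i * q) % q ≡ w r % q
    residue = trans ([m+kn]%n≡m%n (w r % q) i q) (m%n%n≡m%n (w r) q)

  ∈-block⁺ : ∀ {r y} → w r % q ≡ y % q → y < w r → y ∈ block r
  ∈-block⁺ {r} {y} w[r]≡y y<w[r] =
    subst (_∈ block r) (sym y≡) (∈-applyUpTo⁺ _ (%≡∧<⇒/< (sym w[r]≡y) y<w[r]))
    where
    y≡ : y ≡ w r % q + y / q * q
    y≡ = trans (m≡m%n+[m/n]*n y q) (cong (_+ y / q * q) (sym w[r]≡y))

  gaps : List ℕ
  gaps = concat (applyUpTo block q)

  gaps-unique : Unique gaps
  gaps-unique = Unique.concat⁺ (All.applyUpTo⁺₂ block q block-unique)
                               (AllPairs.applyUpTo⁺₁ block q blocks-disjoint)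
    where
    block-unique : ∀ r → Unique (block r)
    block-unique r = Unique.applyUpTo⁺₁ _ (w r / q) λ i<j _ eq →
      <⇒≢ i<j (*-cancelʳ-≡ _ _ q (+-cancelˡ-≡ (w r % q) _ _ eq))
    blocks-disjoint : ∀ {r r'} → r < r' → r' < q → ∀ {y} → ¬ (y ∈ block r × y ∈ block r')
    blocks-disjoint r<r' r'<q (y∈r , y∈r') = <⇒≢ r<r' (residue-injective (<-trans r<r' r'<q) r'<q
      (trans (proj₁ (∈-block⁻ y∈r)) (sym (proj₁ (∈-block⁻ y∈r')))))

  ∈-gaps⁻ : T 0 → ∀ {y} → y ∈ gaps → 1 ≤ y × ¬ T y
  ∈-gaps⁻ 0∈T {y} y∈gaps with ∈-concat⁻′ (applyUpTo block q) y∈gaps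
  ... | xs , y∈xs , xs∈blocks with ∈-applyUpTo⁻ block xs∈blocks
  ...   | r , r<q , refl = n≢0⇒n>0 (λ { refl → y∉T 0∈T }) , y∉T
    where
    y∉T : ¬ T y
    y∉T y∈T with ∈-block⁻ y∈xs
    ... | w[r]≡y , y<w[r] = <⇒≱ y<w[r] (to (∈⇔w≤ r<q w[r]≡y) y∈T)

  ∈-gaps⁺ : ∀ {y} → ¬ T y → y ∈ gaps
  ∈-gaps⁺ {y} y∉T with residue-surjective y
  ... | r , r<q , w[r]≡y = ∈-concat⁺′ (∈-block⁺ w[r]≡y y<w[r]) (∈-applyUpTo⁺ block r<q)
    where
    y<w[r] : y < w r
    y<w[r] = ≰⇒> (λ w[r]≤y → y∉T (from (∈⇔w≤ r<q w[r]≡y) w[r]≤y))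

  length-gaps : length gaps ≡ sum (applyUpTo (λ r → w r / q) q)
  length-gaps = begin
    length (concat (applyUpTo block q))
      ≡⟨ length-concat (applyUpTo block q) ⟩
    sum (map length (applyUpTo block q))
      ≡⟨ cong sum (map-applyUpTo block length q) ⟩
    sum (applyUpTo (λ r → length (block r)) q)
      ≡⟨ sum-applyUpTo-cong q (λ _ → length-applyUpTo _ _) ⟩
    sum (applyUpTo (λ r → w r / q) q) ∎
    where open ≡-Reasoning

  isGenus : T 0 → IsGenus T (sum (applyUpTo (λ r → w r / q) q))
  isGenus 0∈T = gaps , gaps-unique , (λ _ → mk⇔ (∈-gaps⁻ 0∈T) (∈-gaps⁺ ∘ proj₂)) , length-gaps

module Quotient (a u d s p n : ℕ) .{{_ : NonZero p}} (a≡qp : a ≡ suc n * p) (1≤n : 1 ≤ n)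
  (1≤u : 1 ≤ u) (s≤u+1 : s ≤ u + 1) (a⊥d : Coprime a d) where

  q m : ℕ
  q = suc n
  m = u * a + d

  A÷p : Subsetℕ
  A÷p = ⟨ a , (u + 1) * a + d , ((s + 1) * u + 1) * a + (s + 1) * d ⟩ ÷ p

  generators : ∀ x y z → x * a + y * ((u + 1) * a + d) + z * (((s + 1) * u + 1) * a + (s + 1) * d)
                         ≡ (x + y + z) * a + (y + z * suc s) * m
  generators x y z = identity x y z a u d s
    where
    identity : ∀ x y z a u d s →
               x * a + y * ((u + 1) * a + d) + z * (((s + 1) * u + 1) * a + (s + 1) * d)
               ≡ (x + y + z) * a + (y + z * suc s) * (u * a + d)
    identity = solve-∀

  q≤m : q ≤ m
  q≤m = begin
    q       ≤⟨ m≤m*n q p ⟩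
    q * p   ≡⟨ a≡qp ⟨
    a       ≡⟨ *-identityˡ a ⟨
    1 * a   ≤⟨ *-monoˡ-≤ a 1≤u ⟩
    u * a   ≤⟨ m≤m+n (u * a) d ⟩
    m       ∎
    where open ≤-Reasoning

  [s∸1]q≤m : (s ∸ 1) * q ≤ m
  [s∸1]q≤m = begin
    (s ∸ 1) * q ≤⟨ *-mono-≤ s∸1≤u (m≤m*n q p) ⟩
    u * (q * p) ≡⟨ cong (u *_) a≡qp ⟨
    u * a       ≤⟨ m≤m+n (u * a) d ⟩
    m           ∎
    where
    open ≤-Reasoning
    s∸1≤u : s ∸ 1 ≤ u
    s∸1≤u = ≤-trans (∸-monoˡ-≤ 1 s≤u+1) (≤-reflexive (m+n∸n≡m u 1))

  a⊥m : Coprime a m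
  a⊥m (i∣a , i∣m) = a⊥d (i∣a , ∣m+n∣m⇒∣n i∣m (∣-trans i∣a (n∣m*n u)))

  p⊥m : Coprime p m
  p⊥m (i∣p , i∣m) = a⊥m (∣-trans i∣p (divides q a≡qp) , i∣m)

  m⊥q : Coprime m q
  m⊥q (i∣m , i∣q) = a⊥m (∣-trans i∣q (divides p (trans a≡qp (*-comm q p))) , i∣m)

  -- p y = (x + y' + z) a + k m forces p ∣ k, and then y = t q + r m with k = r p.
  ∈A÷p⇔ : ∀ {y} → A÷p y ⇔ ∃ λ t → ∃ λ r → coins s (r * p) ≤ t × t * q + r * m ≡ y
  ∈A÷p⇔ {y} = mk⇔ to from
    where
    open ≡-Reasoning
    scale : ∀ t r → p * (t * q + r * m) ≡ t * a + r * p * m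
    scale t r = trans (rearrange p t q r m) (cong (λ a → t * a + r * p * m) (sym a≡qp))
      where
      rearrange : ∀ p t q r m → p * (t * q + r * m) ≡ t * (q * p) + r * p * m
      rearrange = solve-∀
    to : A÷p y → ∃ λ t → ∃ λ r → coins s (r * p) ≤ t × t * q + r * m ≡ y
    to (x , y' , z , eq) with coprime-divisor p⊥m p∣mk
      where
      eq' : (x + y' + z) * a + (y' + z * suc s) * m ≡ p * y
      eq' = trans (sym (generators x y' z)) eq
      p∣mk : p ∣ m * (y' + z * suc s)
      p∣mk = ∣m+n∣m⇒∣n (subst (p ∣_) (trans (sym eq') (cong ((x + y' + z) * a +_) (*-comm _ m)))
                                      (m∣m*n y))
                      (∣-trans (divides q a≡qp) (n∣m*n (x + y' + z)))
    ... | divides r k≡rp = x + y' + z , r , coins≤ , *-cancelˡ-≡ _ _ p (begin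
      p * ((x + y' + z) * q + r * m)     ≡⟨ scale (x + y' + z) r ⟩
      (x + y' + z) * a + r * p * m       ≡⟨ cong (λ k → (x + y' + z) * a + k * m) k≡rp ⟨
      (x + y' + z) * a + (y' + z * suc s) * m ≡⟨ generators x y' z ⟨
      x * a + y' * _ + z * _             ≡⟨ eq ⟩
      p * y                              ∎)
      where
      coins≤ : coins s (r * p) ≤ x + y' + z
      coins≤ = subst (λ k → coins s k ≤ x + y' + z) k≡rp
                     (≤-trans (coins-minimal s y' z) (+-monoˡ-≤ z (m≤n+m y' x)))
    from : (∃ λ t → ∃ λ r → coins s (r * p) ≤ t × t * q + r * m ≡ y) → A÷p y
    from (t , r , coins≤t , eq) = t ∸ coins s k , k % suc s , k / suc s , (begin
      (t ∸ coins s k) * a + k % suc s * _ + k / suc s * _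
        ≡⟨ generators (t ∸ coins s k) (k % suc s) (k / suc s) ⟩
      (t ∸ coins s k + k % suc s + k / suc s) * a + (k % suc s + k / suc s * suc s) * m
        ≡⟨ cong₂ (λ t' k' → t' * a + k' * m) (trans (+-assoc (t ∸ coins s k) _ _) (m∸n+n≡m coins≤t))
                                             (sym (m≡m%n+[m/n]*n k (suc s))) ⟩
      t * a + k * m                      ≡⟨ scale t r ⟨
      p * (t * q + r * m)                ≡⟨ cong (p *_) eq ⟩
      p * y                              ∎)
      where
      k = r * p

  apery : ℕ → ℕ
  apery r = coins s (r * p) * q + r * m

  apery%q : ∀ r → apery r % q ≡ (r * m) % q
  apery%q r = trans (cong (_% q) (+-comm (coins s (r * p) * q) (r * m)))
                    ([m+kn]%n≡m%n (r * m) (coins s (r * p)) q)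

  apery/q : ∀ r → apery r / q ≡ coins s (r * p) + r * m / q
  apery/q r = trans (+-distrib-/-∣ˡ (r * m) (divides-refl (coins s (r * p))))
                    (cong (_+ r * m / q) (m*n/n≡m _ q))

  -- Raising r costs at least m, more than the at most (s - 1) q saved on coins.
  apery-monotone : ∀ {r r'} → r ≤ r' → apery r ≤ apery r'
  apery-monotone {r} {r'} r≤r' with m≤n⇒m<n∨m≡n r≤r'
  ... | inj₂ refl = ≤-refl
  ... | inj₁ r<r' = begin
    coins s (r * p) * q + r * m
      ≤⟨ +-monoˡ-≤ (r * m) (*-monoˡ-≤ q (coins-almost-monotone s (*-monoˡ-≤ p r≤r'))) ⟩
    (coins s (r' * p) + (s ∸ 1)) * q + r * m
      ≡⟨ rearrange (coins s (r' * p)) (s ∸ 1) q (r * m) ⟩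
    coins s (r' * p) * q + ((s ∸ 1) * q + r * m)
      ≤⟨ +-monoʳ-≤ (coins s (r' * p) * q) (+-monoˡ-≤ (r * m) [s∸1]q≤m) ⟩
    coins s (r' * p) * q + suc r * m
      ≤⟨ +-monoʳ-≤ (coins s (r' * p) * q) (*-monoˡ-≤ m r<r') ⟩
    coins s (r' * p) * q + r' * m ∎
    where
    open ≤-Reasoning
    rearrange : ∀ c e q x → (c + e) * q + x ≡ c * q + (e * q + x)
    rearrange = solve-∀

  ∈A÷p⇔apery≤ : ∀ {R y} → R < q → apery R % q ≡ y % q → A÷p y ⇔ apery R ≤ y
  ∈A÷p⇔apery≤ {R} {y} R<q R≡y = mk⇔ to from
    where
    to : A÷p y → apery R ≤ y
    to y∈A÷p = bound (Equivalence.to (∈A÷p⇔ {y}) y∈A÷p)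
      where
      bound : (∃ λ t → ∃ λ r → coins s (r * p) ≤ t × t * q + r * m ≡ y) → apery R ≤ y
      bound (t , r , coins≤t , eq) = begin
        apery R        ≤⟨ apery-monotone (subst (_≤ r) r%q≡R (m%n≤m r q)) ⟩
        apery r        ≤⟨ +-monoˡ-≤ (r * m) (*-monoˡ-≤ q coins≤t) ⟩
        t * q + r * m  ≡⟨ eq ⟩
        y              ∎
        where
        open ≤-Reasoning
        r%q≡R : r % q ≡ R
        r%q≡R = *-cancelʳ-% m⊥q (m%n<n r q) R<q (begin-equality
          (r % q * m) % q       ≡⟨ %-*-congʳ {q} {r % q} {r} m (m%n%n≡m%n r q) ⟩
          (r * m) % q           ≡⟨ [m+kn]%n≡m%n (r * m) t q ⟨
          (r * m + t * q) % q   ≡⟨ cong (_% q) (trans (+-comm (r * m) (t * q)) eq) ⟩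
          y % q                 ≡⟨ R≡y ⟨
          apery R % q           ≡⟨ apery%q R ⟩
          (R * m) % q           ∎)
    from : apery R ≤ y → A÷p y
    from apery≤y with %≡∧≤⇒+* R≡y apery≤y
    ... | k , y≡ = Equivalence.from (∈A÷p⇔ {y})
      (coins s (R * p) + k , R , m≤m+n _ k , sym (trans y≡ (rearrange (coins s (R * p)) q (R * m) k)))
      where
      rearrange : ∀ c q x k → c * q + x + k * q ≡ (c + k) * q + x
      rearrange = solve-∀

  apery-residue-injective : ∀ {r r'} → r < q → r' < q → apery r % q ≡ apery r' % q → r ≡ r'
  apery-residue-injective {r} {r'} r<q r'<q eq =
    *-cancelʳ-% m⊥q r<q r'<q (trans (sym (apery%q r)) (trans eq (apery%q r')))

  apery-residue-surjective : ∀ y → ∃ λ r → r < q × apery r % q ≡ y % q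
  apery-residue-surjective y with *-surjectiveʳ-% m⊥q y
  ... | r , r<q , eq = r , r<q , trans (apery%q r) eq

  open Apéry {A÷p} apery apery-residue-injective apery-residue-surjective ∈A÷p⇔apery≤

  frobenius : ∃ λ F → IsFrobenius A÷p F × F + q ≡ ((a ∸ p) ∸ s * ((a ∸ p) / suc s)) * q + n * m
  frobenius = apery n ∸ q
            , isFrobenius ≤-refl (λ r<q → apery-monotone (s≤s⁻¹ r<q)) q≤apery[n]
            , (begin
    apery n ∸ q + q                                ≡⟨ m∸n+n≡m q≤apery[n] ⟩
    coins s (n * p) * q + n * m                    ≡⟨ cong (λ c → c * q + n * m) coins[np] ⟩
    ((a ∸ p) ∸ s * ((a ∸ p) / suc s)) * q + n * m  ∎)
    where
    open ≡-Reasoning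
    q≤apery[n] : q ≤ apery n
    q≤apery[n] = ≤-trans q≤m (≤-trans (m≤n*m m n {{>-nonZero 1≤n}}) (m≤n+m (n * m) _))
    a∸p≡np : a ∸ p ≡ n * p
    a∸p≡np = trans (cong (_∸ p) a≡qp) (m+n∸m≡n p (n * p))
    coins[np] : coins s (n * p) ≡ (a ∸ p) ∸ s * ((a ∸ p) / suc s)
    coins[np] = begin
      coins s (n * p)
        ≡⟨ m+n∸n≡m (coins s (n * p)) (s * (n * p / suc s)) ⟨
      coins s (n * p) + s * (n * p / suc s) ∸ s * (n * p / suc s)
        ≡⟨ cong (_∸ s * (n * p / suc s)) (coins+s*/ s (n * p)) ⟩
      n * p ∸ s * (n * p / suc s)
        ≡⟨ cong (λ k → k ∸ s * (k / suc s)) a∸p≡np ⟨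
      (a ∸ p) ∸ s * ((a ∸ p) / suc s) ∎

  apery/q-sum : sum (applyUpTo (λ r → apery r / q) q) + s * sum (map (λ i → suc i * p / suc s) (upTo n))
                ≡ sum (applyUpTo (λ i → suc i * p + suc i * m / q) n)
  apery/q-sum = begin
    sum (applyUpTo (λ i → apery (suc i) / q) n) + s * sum (map (λ i → suc i * p / suc s) (upTo n))
      ≡⟨ cong₂ _+_ (sum-applyUpTo-cong n (λ {i} _ → apery/q (suc i)))
                   (trans (cong (λ xs → s * sum xs) (map-upTo _ n)) (*-distribˡ-sum-applyUpTo s _ n)) ⟩
    sum (applyUpTo (λ i → coins s (suc i * p) + suc i * m / q) n)
      + sum (applyUpTo (λ i → s * (suc i * p / suc s)) n)
      ≡⟨ sum-applyUpTo-+ _ _ n ⟨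
    sum (applyUpTo (λ i → coins s (suc i * p) + suc i * m / q + s * (suc i * p / suc s)) n)
      ≡⟨ sum-applyUpTo-cong n (λ {i} _ → coins-cancel (suc i * p) (suc i * m / q)) ⟩
    sum (applyUpTo (λ i → suc i * p + suc i * m / q) n) ∎
    where
    open ≡-Reasoning
    swap : ∀ x y z → x + y + z ≡ x + z + y
    swap = solve-∀
    coins-cancel : ∀ k f → coins s k + f + s * (k / suc s) ≡ k + f
    coins-cancel k f = trans (swap (coins s k) f _) (cong (_+ f) (coins+s*/ s k))

  complementary-terms : ∀ {i} → i < n →
    suc i * p + suc i * m / q + (suc (n ∸ suc i) * p + suc (n ∸ suc i) * m / q) ≡ a + (m ∸ 1)
  complementary-terms {i} i<n = trans (interchange (suc i * p) _ _ _) (cong₂ _+_ ps fs)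
    where
    interchange : ∀ w x y z → w + x + (y + z) ≡ w + y + (x + z)
    interchange = solve-∀
    j = n ∸ suc i
    i+j≡q : suc i + suc j ≡ q
    i+j≡q = trans (+-suc (suc i) j) (cong suc (m+[n∸m]≡n i<n))
    ps : suc i * p + suc j * p ≡ a
    ps = trans (sym (*-distribʳ-+ p (suc i) (suc j))) (trans (cong (_* p) i+j≡q) (sym a≡qp))
    im+jm≡mq : suc i * m + suc j * m ≡ m * q
    im+jm≡mq = trans (sym (*-distribʳ-+ m (suc i) (suc j))) (trans (cong (_* m) i+j≡q) (*-comm q m))
    fs : suc i * m / q + suc j * m / q ≡ m ∸ 1
    fs = cong pred (/-pairing {q} {suc i * m} {suc j * m} {m} im+jm≡mq
                              (λ eq → 1+n≢0 (*-cancelʳ-% m⊥q (s≤s i<n) (>-nonZero⁻¹ q) eq)))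

  genus : ∃ λ g → IsGenus A÷p g
            × 2 * (g + s * sum (map (λ i → suc i * p / suc s) (upTo n))) ≡ n * (u * a + a + d ∸ 1)
  genus = _ , isGenus (0 , 0 , 0 , sym (*-zeroʳ p)) , (begin
    2 * (sum (applyUpTo (λ r → apery r / q) q) + s * sum (map (λ i → suc i * p / suc s) (upTo n)))
      ≡⟨ cong (2 *_) apery/q-sum ⟩
    2 * sum (applyUpTo (λ i → suc i * p + suc i * m / q) n)
      ≡⟨ sum-applyUpTo-pairing _ n (a + (m ∸ 1)) complementary-terms ⟩
    n * (a + (m ∸ 1))
      ≡⟨ cong (n *_) (trans (sym (+-∸-assoc a 1≤m)) (cong (_∸ 1) (rearrange a u d))) ⟩
    n * (u * a + a + d ∸ 1) ∎)
    where
    open ≡-Reasoning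
    1≤m : 1 ≤ m
    1≤m = ≤-trans (s≤s z≤n) q≤m
    rearrange : ∀ a u d → a + (u * a + d) ≡ u * a + a + d
    rearrange = solve-∀

proper-divisor-cofactor : ∀ {a p} → p ∣ a → 1 ≤ a → p ≢ a → ∃ λ n → 1 ≤ n × a ≡ suc n * p
proper-divisor-cofactor (divides zero          a≡0)   1≤a _   = ⊥-elim (<⇒≢ 1≤a (sym a≡0))
proper-divisor-cofactor (divides (suc zero)    a≡p+0) _   p≢a =
  ⊥-elim (p≢a (sym (trans a≡p+0 (+-identityʳ _))))
proper-divisor-cofactor (divides (suc (suc n)) a≡)    _   _   = suc n , s≤s z≤n , a≡

proposition4p1 : (a u d s p : ℕ) .{{_ : NonZero p}} →
    1 ≤ u → 1 ≤ d → gcd a d ≡ 1 → 2 ≤ a → 1 ≤ s → s ≤ u + 1 →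
    p ∣ a → p ≢ a →
    (∃ λ F → IsFrobenius (⟨ a , (u + 1) * a + d , ((s + 1) * u + 1) * a + (s + 1) * d ⟩ ÷ p) F
      × F + a / p ≡ ((a ∸ p) ∸ s * ((a ∸ p) / suc s)) * (a / p) + (a / p ∸ 1) * (u * a + d))
    × (∃ λ g → IsGenus (⟨ a , (u + 1) * a + d , ((s + 1) * u + 1) * a + (s + 1) * d ⟩ ÷ p) g
      × 2 * (g + s * sum (map (λ i → (suc i * p) / suc s) (upTo (a / p ∸ 1))))
        ≡ (a / p ∸ 1) * (u * a + a + d ∸ 1))
proposition4p1 a u d s p 1≤u _ gcd[a,d]≡1 2≤a _ s≤u+1 p∣a p≢a
  with proper-divisor-cofactor p∣a (≤-trans (s≤s z≤n) 2≤a) p≢a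
... | n , 1≤n , a≡[1+n]p rewrite trans (cong (_/ p) a≡[1+n]p) (m*n/n≡m (suc n) p) = frobenius , genus
  where open Quotient a u d s p n a≡[1+n]p 1≤n 1≤u s≤u+1 (gcd≡1⇒coprime gcd[a,d]≡1)
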